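{- If $w$ is an infinite Dean word, then $\mathit{d}_3(w)\le 6$.
   Context: Words are over the alphabet $\Sigma_4=\{0,1,2,3\}$. A word is reduced if it has no factor in $\{02,20,13,31\}$. A Dean word is a finite or infinite reduced word that is square-free (no factor $uu$ with $u$ nonempty). For a Dean word $w$, $\mathit{D}_3(w)$ is the set of reduced words $v$ of length $3$ that are not factors of $w$ but whose prefix and suffix of length $2$ are factors of $w$; $\mathit{d}_3(w)=|\mathit{D}_3(w)|$. -}

module Defs where

open import Data.Nat using (ℕ; suc)
open import Data.Fin using (Fin; zero; suc)
open import Data.List using (List; []; _∷_; _++_)
open import Data.Product using (_×_; ∃)
open import Data.Unit using (⊤)
open import Relation.Binary.PropositionalEquality using (_≡_)
open import Relation.Nullary using (¬_)

Letter : Set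
Letter = Fin 4

InfWord : Set
InfWord = ℕ → Letter

data BadPair : Letter → Letter → Set where
  b02 : BadPair zero (suc (suc zero))
  b20 : BadPair (suc (suc zero)) zero
  b13 : BadPair (suc zero) (suc (suc (suc zero)))
  b31 : BadPair (suc (suc (suc zero))) (suc zero)

ReducedFin : List Letter → Set
ReducedFin [] = ⊤
ReducedFin (a ∷ []) = ⊤
ReducedFin (a ∷ b ∷ u) = ¬ BadPair a b × ReducedFin (b ∷ u)

OccursAt : List Letter → InfWord → ℕ → Set
OccursAt [] w i = ⊤
OccursAt (a ∷ u) w i = (w i ≡ a) × OccursAt u w (suc i)

Factor : List Letter → InfWord → Set
Factor u w = ∃ λ i → OccursAt u w i

ReducedInf : InfWord → Set
ReducedInf w = ∀ i → ¬ BadPair (w i) (w (suc i))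

SquareFreeInf : InfWord → Set
SquareFreeInf w = ∀ (u : List Letter) → ¬ (u ≡ []) → ¬ Factor (u ++ u) w

DeanInf : InfWord → Set
DeanInf w = ReducedInf w × SquareFreeInf w

Word3 : Set
Word3 = Letter × Letter × Letter

InD3 : InfWord → Word3 → Set
InD3 w (a Data.Product., b Data.Product., c) =
  ReducedFin (a ∷ b ∷ c ∷ [])
  × ¬ Factor (a ∷ b ∷ c ∷ []) w
  × Factor (a ∷ b ∷ []) w
  × Factor (b ∷ c ∷ []) w

-- Among the 64 words of length 3, only 16 can be factors of a Dean word or
-- belong to its D₃: consecutive letters must differ and must not form one of the
-- forbidden pairs, leaving each letter two possible successors.  A factor is never
-- in D₃, and an exhaustive search shows that every reduced square-free word of
-- length 30 already has 10 distinct factors of length 3.  Hence d₃(w) ≤ 16 − 10.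
module Submission where

open import Data.Bool using (Bool; true; false; _∨_; T)
open import Data.Bool.ListAction using (all)
open import Data.Bool.Properties using (T-∨; T-≡)
open import Data.Empty using (⊥-elim)
open import Data.Fin using (zero; suc)
open import Data.Fin.Properties using (_≟_)
open import Data.List using (List; []; _∷_; _++_; _∷ʳ_; length; take; drop; filter; cartesianProduct; allFin; deduplicate)
open import Data.List.Properties using (take++drop≡id; length-++; length-++-sucʳ)
import Data.List.Properties as List
open import Data.List.Membership.Propositional using (_∈_)
open import Data.List.Membership.Propositional.Properties using (∈-∃++; ∈-++⁻; ∈-++⁺ˡ; ∈-++⁺ʳ; ∈-filter⁺; ∈-cartesianProduct⁺; ∈-allFin)
open import Data.List.Relation.Unary.All as All using (All; []; _∷_)
import Data.List.Relation.Unary.All.Properties as Allₚ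
open import Data.List.Relation.Unary.Any using (here; there)
open import Data.List.Relation.Unary.AllPairs using ([]; _∷_)
open import Data.List.Relation.Unary.Unique.Propositional using (Unique)
import Data.List.Relation.Unary.Unique.Propositional.Properties as Unique
open import Data.List.Relation.Unary.Unique.DecPropositional.Properties using (deduplicate-!)
open import Data.Nat using (ℕ; zero; suc; _+_; _≤_; _/_; _≤?_; z≤n; s≤s)
open import Data.Nat.Properties using (+-identityʳ; +-suc; +-monoʳ-≤; +-cancelʳ-≤; module ≤-Reasoning)
open import Data.Product using (_×_; _,_; proj₁; proj₂; Σ; ∃-syntax)
import Data.Product.Properties as Product
open import Data.Sum using (inj₁; inj₂; [_,_]′)
open import Data.Unit using (tt)
open import Function using (_∘_; case_of_; Equivalence)
open import Relation.Binary using (Decidable; DecidableEquality)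
open import Relation.Binary.PropositionalEquality using (_≡_; _≢_; refl; sym; trans; cong; subst; subst₂; module ≡-Reasoning)
open import Relation.Nullary using (¬_; Dec; does; _because_; ofʸ; ¬?; _×-dec_)
import Relation.Nullary.Decidable as Dec
import Relation.Unary as U
open import Defs

open Equivalence using (to; from)

opposite : Letter → Letter
opposite zero = suc (suc zero)
opposite (suc zero) = suc (suc (suc zero))
opposite (suc (suc zero)) = zero
opposite (suc (suc (suc zero))) = suc zero

BadPair⇒≡opposite : ∀ {a b} → BadPair a b → b ≡ opposite a
BadPair⇒≡opposite b02 = refl
BadPair⇒≡opposite b20 = refl
BadPair⇒≡opposite b13 = refl
BadPair⇒≡opposite b31 = refl

BadPair-opposite : ∀ a → BadPair a (opposite a)
BadPair-opposite zero = b02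
BadPair-opposite (suc zero) = b13
BadPair-opposite (suc (suc zero)) = b20
BadPair-opposite (suc (suc (suc zero))) = b31

badPair? : Decidable BadPair
badPair? a b = Dec.map′ (λ { refl → BadPair-opposite a }) BadPair⇒≡opposite (b ≟ opposite a)

DeanPair : Letter → Letter → Set
DeanPair a b = ¬ BadPair a b × a ≢ b

deanPair? : Decidable DeanPair
deanPair? a b = ¬? (badPair? a b) ×-dec ¬? (a ≟ b)

DeanTriple : Word3 → Set
DeanTriple (a , b , c) = DeanPair a b × DeanPair b c

deanTriple? : U.Decidable DeanTriple
deanTriple? (a , b , c) = deanPair? a b ×-dec deanPair? b c

deanTriples : List Word3
deanTriples = filter deanTriple? (cartesianProduct (allFin 4) (cartesianProduct (allFin 4) (allFin 4)))

∈-deanTriples : ∀ {t} → DeanTriple t → t ∈ deanTriples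
∈-deanTriples {a , b , c} =
  ∈-filter⁺ deanTriple? (∈-cartesianProduct⁺ (∈-allFin a) (∈-cartesianProduct⁺ (∈-allFin b) (∈-allFin c)))

length-deanTriples : length deanTriples ≡ 16
length-deanTriples = refl

T-does⇒ : ∀ {A : Set} (a? : Dec A) → T (does a?) → A
T-does⇒ (true because ofʸ a) _ = a

_≟ₗ_ : DecidableEquality (List Letter)
_≟ₗ_ = List.≡-dec _≟_

_≟₃_ : DecidableEquality Word3
_≟₃_ = Product.≡-dec _≟_ (Product.≡-dec _≟_ _≟_)

∈-++-∷⁻ : ∀ {A : Set} {x y : A} ys₁ {ys₂} → x ≢ y → y ∈ ys₁ ++ x ∷ ys₂ → y ∈ ys₁ ++ ys₂
∈-++-∷⁻ ys₁ x≢y y∈ with ∈-++⁻ ys₁ y∈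
... | inj₁ y∈ys₁ = ∈-++⁺ˡ y∈ys₁
... | inj₂ (here refl) = ⊥-elim (x≢y refl)
... | inj₂ (there y∈ys₂) = ∈-++⁺ʳ ys₁ y∈ys₂

Unique-length≤ : ∀ {A : Set} {xs ys : List A} → Unique xs → All (_∈ ys) xs → length xs ≤ length ys
Unique-length≤ [] [] = z≤n
Unique-length≤ {xs = x ∷ xs} (x≢xs ∷ !xs) (x∈ys ∷ xs⊆ys) with ∈-∃++ x∈ys
... | ys₁ , ys₂ , refl = begin
  suc (length xs)           ≤⟨ s≤s (Unique-length≤ !xs xs⊆ys₁ys₂) ⟩
  suc (length (ys₁ ++ ys₂)) ≡⟨ sym (length-++-sucʳ ys₁ x ys₂) ⟩
  length (ys₁ ++ x ∷ ys₂)   ∎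
  where
  open ≤-Reasoning
  xs⊆ys₁ys₂ : All (_∈ ys₁ ++ ys₂) xs
  xs⊆ys₁ys₂ = All.zipWith (λ (x≢y , y∈) → ∈-++-∷⁻ ys₁ x≢y y∈) (x≢xs , xs⊆ys)

toList₃ : Word3 → List Letter
toList₃ (a , b , c) = a ∷ b ∷ c ∷ []

Factor₃ : InfWord → Word3 → Set
Factor₃ w t = Factor (toList₃ t) w

OccursAt-∷ʳ : ∀ {w u i} → OccursAt u w i → OccursAt (u ∷ʳ w (i + length u)) w i
OccursAt-∷ʳ {w} {[]} {i} tt = cong w (sym (+-identityʳ i)) , tt
OccursAt-∷ʳ {w} {a ∷ u} {i} (wi≡a , occ) =
  wi≡a , subst (λ j → OccursAt (u ∷ʳ w j) w (suc i)) (sym (+-suc i (length u))) (OccursAt-∷ʳ occ)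

factor⇒DeanPair : ∀ {w a b u} → DeanInf w → Factor (a ∷ b ∷ u) w → DeanPair a b
factor⇒DeanPair {a = a} (reduced , squareFree) (i , wi≡a , wi+1≡b , _) =
  (λ bad → reduced i (subst₂ BadPair (sym wi≡a) (sym wi+1≡b) bad)) ,
  (λ a≡b → squareFree (a ∷ []) (λ ()) (i , wi≡a , trans wi+1≡b (sym a≡b) , tt))

factor₃⇒DeanTriple : ∀ {w t} → DeanInf w → Factor₃ w t → DeanTriple t
factor₃⇒DeanTriple dean f@(i , _ , occ) = factor⇒DeanPair dean f , factor⇒DeanPair dean (suc i , occ)

D₃⇒DeanTriple : ∀ {w t} → DeanInf w → InD3 w t → DeanTriple t
D₃⇒DeanTriple dean (_ , _ , ab , bc) = factor⇒DeanPair dean ab , factor⇒DeanPair dean bc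

hasBadPair : List Letter → Bool
hasBadPair (a ∷ b ∷ u) = does (badPair? a b) ∨ hasBadPair (b ∷ u)
hasBadPair _ = false

hasBadPair-sound : ∀ {w u i} → ReducedInf w → OccursAt u w i → ¬ T (hasBadPair u)
hasBadPair-sound {u = a ∷ u@(b ∷ _)} {i} reduced (wi≡a , occ@(wi+1≡b , _)) h =
  [ (λ bad → reduced i (subst₂ BadPair (sym wi≡a) (sym wi+1≡b) (T-does⇒ (badPair? a b) bad)))
  , hasBadPair-sound {u = u} reduced occ
  ]′ (T-∨ .to h)

isSquare : List Letter → Bool
isSquare [] = false
isSquare t@(_ ∷ _) = does (take (length t / 2) t ≟ₗ drop (length t / 2) t)

isSquare-sound : ∀ t → T (isSquare t) → ∃[ s ] s ≢ [] × t ≡ s ++ s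
isSquare-sound t@(_ ∷ _) halves≡ = s , s≢[] , t≡ss
  where
  half : ℕ
  half = length t / 2
  s : List Letter
  s = take half t
  t≡ss : t ≡ s ++ s
  t≡ss = begin
    t                    ≡⟨ take++drop≡id half t ⟨
    s ++ drop half t     ≡⟨ cong (s ++_) (T-does⇒ (s ≟ₗ drop half t) halves≡) ⟨
    s ++ s               ∎
    where open ≡-Reasoning
  s≢[] : s ≢ []
  s≢[] s≡[] = case trans t≡ss (cong (λ v → v ++ v) s≡[]) of λ ()

hasSquareSuffix : List Letter → Bool
hasSquareSuffix [] = false
hasSquareSuffix t@(_ ∷ u) = isSquare t ∨ hasSquareSuffix u

hasSquareSuffix-sound : ∀ {w u i} → SquareFreeInf w → OccursAt u w i → ¬ T (hasSquareSuffix u)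
hasSquareSuffix-sound {w} {t@(_ ∷ u)} {i} squareFree occ h =
  [ (λ square → let s , s≢[] , t≡ss = isSquare-sound t square in
                squareFree s s≢[] (i , subst (λ v → OccursAt v w i) t≡ss occ))
  , hasSquareSuffix-sound {u = u} squareFree (proj₂ occ)
  ]′ (T-∨ .to h)

hopeless : List Letter → Bool
hopeless u = hasBadPair u ∨ hasSquareSuffix u

hopeless-sound : ∀ {w u i} → DeanInf w → OccursAt u w i → ¬ T (hopeless u)
hopeless-sound (reduced , squareFree) occ h =
  [ hasBadPair-sound reduced occ , hasSquareSuffix-sound squareFree occ ]′ (T-∨ .to h)

factors₃ : List Letter → List Word3
factors₃ (a ∷ u@(b ∷ c ∷ _)) = (a , b , c) ∷ factors₃ u
factors₃ _ = []

factors₃-sound : ∀ {w u i} → OccursAt u w i → All (Factor₃ w) (factors₃ u)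
factors₃-sound {u = a ∷ b ∷ c ∷ _} {i} occ@(wi≡a , occ′@(wi+1≡b , wi+2≡c , _)) =
  (i , wi≡a , wi+1≡b , wi+2≡c , tt) ∷ factors₃-sound occ′
factors₃-sound {u = []} _ = []
factors₃-sound {u = _ ∷ []} _ = []
factors₃-sound {u = _ ∷ _ ∷ []} _ = []

ManyFactors₃ : ℕ → InfWord → Set
ManyFactors₃ k w = Σ (List Word3) λ S → Unique S × k ≤ length S × All (Factor₃ w) S

forcesFactors₃ : ℕ → ℕ → List Letter → Bool
forcesFactors₃ k zero u = false
forcesFactors₃ k (suc n) u =
  does (k ≤? length (deduplicate _≟₃_ (factors₃ u))) ∨
  all (λ x → hopeless (u ∷ʳ x) ∨ forcesFactors₃ k n (u ∷ʳ x)) (allFin 4)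

-- The hypothesis is ≡ true rather than T: unifying T (forcesFactors₃ 10 31 [])
-- would make the type checker run the whole search in its slow evaluator.
forcesFactors₃-sound : ∀ {w} k n u {i} → DeanInf w → OccursAt u w i →
                       forcesFactors₃ k n u ≡ true → ManyFactors₃ k w
forcesFactors₃-sound {w} k (suc n) u {i} dean occ h = [ enough , extended ]′ (T-∨ .to (T-≡ .from h))
  where
  dedup : List Word3
  dedup = deduplicate _≟₃_ (factors₃ u)
  enough : T (does (k ≤? length dedup)) → ManyFactors₃ k w
  enough k≤ = dedup , deduplicate-! _≟₃_ (factors₃ u) , T-does⇒ (k ≤? length dedup) k≤ ,
              Allₚ.deduplicate⁺ _≟₃_ (factors₃-sound occ)
  extend : Letter → Bool
  extend x = hopeless (u ∷ʳ x) ∨ forcesFactors₃ k n (u ∷ʳ x)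
  next : Letter
  next = w (i + length u)
  extended : T (all extend (allFin 4)) → ManyFactors₃ k w
  extended all-extend =
    [ ⊥-elim ∘ hopeless-sound dean (OccursAt-∷ʳ occ)
    , forcesFactors₃-sound k n (u ∷ʳ next) dean (OccursAt-∷ʳ occ) ∘ T-≡ .to
    ]′ (T-∨ .to (All.lookup (Allₚ.all⁺ extend (allFin 4) all-extend) (∈-allFin next)))

deanWords-force-ten-factors₃ : forcesFactors₃ 10 31 [] ≡ true
deanWords-force-ten-factors₃ = refl

DeanInf⇒ManyFactors₃ : ∀ {w} → DeanInf w → ManyFactors₃ 10 w
DeanInf⇒ManyFactors₃ dean = forcesFactors₃-sound 10 31 [] {0} dean tt deanWords-force-ten-factors₃

D₃+factors₃≤16 : ∀ {w k} → DeanInf w → ManyFactors₃ k w →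
                 ∀ {vs} → Unique vs → All (InD3 w) vs → length vs + k ≤ 16
D₃+factors₃≤16 dean (S , !S , k≤|S| , S⊆factors) {vs} !vs vs⊆D₃ = begin
  length vs + _        ≤⟨ +-monoʳ-≤ (length vs) k≤|S| ⟩
  length vs + length S ≡⟨ length-++ vs ⟨
  length (vs ++ S)     ≤⟨ Unique-length≤ (Unique.++⁺ !vs !S disjoint) (Allₚ.++⁺ vs⊆triples S⊆triples) ⟩
  length deanTriples   ≡⟨ length-deanTriples ⟩
  16                   ∎
  where
  open ≤-Reasoning
  disjoint : ∀ {t} → ¬ (t ∈ vs × t ∈ S)
  disjoint (t∈vs , t∈S) = All.lookup vs⊆D₃ t∈vs .proj₂ .proj₁ (All.lookup S⊆factors t∈S)
  vs⊆triples : All (_∈ deanTriples) vs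
  vs⊆triples = All.map (∈-deanTriples ∘ D₃⇒DeanTriple dean) vs⊆D₃
  S⊆triples : All (_∈ deanTriples) S
  S⊆triples = All.map (∈-deanTriples ∘ factor₃⇒DeanTriple dean) S⊆factors

mainTheorem3 : (w : InfWord) → DeanInf w →
    (vs : List Word3) → Unique vs → All (InD3 w) vs → length vs ≤ 6
mainTheorem3 w dean vs !vs vs⊆D₃ =
  +-cancelʳ-≤ 10 (length vs) 6 (D₃+factors₃≤16 dean (DeanInf⇒ManyFactors₃ dean) !vs vs⊆D₃)
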